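{- Let $A=(Ctrl,Sto,\mathit{init},\mathit{fin},\to)$ and $A'=(Ctrl',Sto',\mathit{init}',\mathit{fin}',\to')$ be automata and $\mathcal{Q},\mathcal{S}\subseteq Sto\times Sto'$ with $A,A'\models\langle\mathcal{Q}\leadsto\mathcal{S}\rangle$. Then there exist live alignment conditions $L,R,J$, a keep set $K$, and an annotation $an$ of $\prod(A,A',L,R,J,K)$ for $\{\mathcal{Q}\}\{\mathcal{S}\}$ such that $\prod(A,A',L,R,J,K)$ is $\mathcal{Q}$-adequate in the $\forall\exists$ sense and $an$ is valid.
   Context: An automaton is $(Ctrl,Sto,\mathit{init},\mathit{fin},\to)$ with $Sto$ a set, $Ctrl$ a finite set containing distinct $\mathit{init},\mathit{fin}$, and $\to\ \subseteq(Ctrl\times Sto)^2$ such that $(n,s)\to(m,t)$ implies $n\neq\mathit{fin}$ and $n\neq m$. $A,A'\models\langle\mathcal{Q}\leadsto\mathcal{S}\rangle$ means: for all $(s,s')\in\mathcal{Q}$ and $t$ with $(\mathit{init},s)\to^*(\mathit{fin},t)$ there is $t'$ with $(\mathit{init}',s')\to'^*(\mathit{fin}',t')$ and $(t,t')\in\mathcal{S}$. $L,R,J\subseteq(Ctrl\times Ctrl')\times(Sto\times Sto')$ are live if states in $L$ have a left successor, in $R$ a right successor, in $J$ both. Unfiltered product transitions $((n,n'),(s,s'))\Rightarrow((m,m'),(t,t'))$: (LO) source in $L$, $(n,s)\to(m,t)$, $(n',s')=(m',t')$; (RO) source in $R$, $(n,s)=(m,t)$, $(n',s')\to'(m',t')$;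 (JO) source in $J$, both sides step. For $K\subseteq(Ctrl\times Ctrl')\times(Sto\times Sto')$, $\prod(A,A',L,R,J,K)$ is the automaton with control points $Ctrl\times Ctrl'$, stores $Sto\times Sto'$, initial $(\mathit{init},\mathit{init}')$, final $(\mathit{fin},\mathit{fin}')$ and transitions $X\Rightarrow_K Y$ iff $X\Rightarrow Y$ and $Y\in K$. It is $\mathcal{Q}$-adequate in the $\forall\exists$ sense if for all $(s,s')\in\mathcal{Q}$ and $t$ with $(\mathit{init},s)\to^*(\mathit{fin},t)$ there exists $t'$ with $((\mathit{init},\mathit{init}'),(s,s'))\Rightarrow_K^*((\mathit{fin},\mathit{fin}'),(t,t'))$. An annotation of $\prod(A,A',L,R,J,K)$ for $\{\mathcal{Q}\}\{\mathcal{S}\}$ is a map $an$ from $Ctrl\times Ctrl'$ to subsets of $Sto\times Sto'$ with $an(\mathit{init},\mathit{init}')=\mathcal{Q}$, $an(\mathit{fin},\mathit{fin}')=\mathcal{S}$; it is valid if $(s,s')\in an(n,n')$ and $((n,n'),(s,s'))\Rightarrow_K((m,m'),(t,t'))$ imply $(t,t')\in an(m,m')$. -}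

module Defs where

open import Data.Nat using (ℕ)
open import Data.Fin using (Fin)
open import Data.Product using (_×_; _,_; Σ; ∃; ∃-syntax)
open import Relation.Binary.PropositionalEquality using (_≡_; _≢_)
open import Relation.Binary.Construct.Closure.ReflexiveTransitive using (Star)
open import Function.Bundles using (_↔_)

Pred : Set → Set₁
Pred X = X → Set

record Automaton : Set₁ where
  field
    Ctrl     : Set
    Sto      : Set
    ctrlSize : ℕ
    ctrlFin  : Ctrl ↔ Fin ctrlSize
    init     : Ctrl
    fin      : Ctrl
    init≢fin : init ≢ fin
    _⟶_      : Ctrl × Sto → Ctrl × Sto → Set
    noFromFin : ∀ {n s m t} → (n , s) ⟶ (m , t) → n ≢ fin
    noSelf    : ∀ {n s m t} → (n , s) ⟶ (m , t) → n ≢ m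

open Automaton public

_⊢_⟶*_ : (A : Automaton) → Ctrl A × Sto A → Ctrl A × Sto A → Set
A ⊢ x ⟶* y = Star (_⟶_ A) x y

Sat : (A A' : Automaton) → Pred (Sto A × Sto A') → Pred (Sto A × Sto A') → Set
Sat A A' Q S =
  ∀ s s' t → Q (s , s') → A ⊢ (init A , s) ⟶* (fin A , t) →
  ∃[ t' ] (A' ⊢ (init A' , s') ⟶* (fin A' , t') × S (t , t'))

PState : (A A' : Automaton) → Set
PState A A' = (Ctrl A × Ctrl A') × (Sto A × Sto A')

LiveL : (A A' : Automaton) → Pred (PState A A') → Set
LiveL A A' L = ∀ n n' s s' → L ((n , n') , (s , s')) →
  ∃[ m ] ∃[ t ] (_⟶_ A) (n , s) (m , t)

LiveR : (A A' : Automaton) → Pred (PState A A') → Set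
LiveR A A' R = ∀ n n' s s' → R ((n , n') , (s , s')) →
  ∃[ m' ] ∃[ t' ] (_⟶_ A') (n' , s') (m' , t')

LiveJ : (A A' : Automaton) → Pred (PState A A') → Set
LiveJ A A' J = ∀ n n' s s' → J ((n , n') , (s , s')) →
  (∃[ m ] ∃[ t ] (_⟶_ A) (n , s) (m , t)) ×
  (∃[ m' ] ∃[ t' ] (_⟶_ A') (n' , s') (m' , t'))

Live : (A A' : Automaton) → (L R J : Pred (PState A A')) → Set
Live A A' L R J = LiveL A A' L × LiveR A A' R × LiveJ A A' J

data Unfiltered (A A' : Automaton) (L R J : Pred (PState A A')) :
     PState A A' → PState A A' → Set where
  LO : ∀ {n n' s s' m t} → L ((n , n') , (s , s')) →
       (_⟶_ A) (n , s) (m , t) →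
       Unfiltered A A' L R J ((n , n') , (s , s')) ((m , n') , (t , s'))
  RO : ∀ {n n' s s' m' t'} → R ((n , n') , (s , s')) →
       (_⟶_ A') (n' , s') (m' , t') →
       Unfiltered A A' L R J ((n , n') , (s , s')) ((n , m') , (s , t'))
  JO : ∀ {n n' s s' m m' t t'} → J ((n , n') , (s , s')) →
       (_⟶_ A) (n , s) (m , t) → (_⟶_ A') (n' , s') (m' , t') →
       Unfiltered A A' L R J ((n , n') , (s , s')) ((m , m') , (t , t'))

Filtered : (A A' : Automaton) (L R J K : Pred (PState A A')) →
           PState A A' → PState A A' → Set
Filtered A A' L R J K X Y = Unfiltered A A' L R J X Y × K Y

Adequate : (A A' : Automaton) (L R J K : Pred (PState A A')) →
           Pred (Sto A × Sto A') → Set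
Adequate A A' L R J K Q =
  ∀ s s' t → Q (s , s') → A ⊢ (init A , s) ⟶* (fin A , t) →
  ∃[ t' ] Star (Filtered A A' L R J K)
             ((init A , init A') , (s , s')) ((fin A , fin A') , (t , t'))

_≐_ : {X : Set} → Pred X → Pred X → Set
P ≐ P' = ∀ x → (P x → P' x) × (P' x → P x)

IsAnnotation : (A A' : Automaton) →
               (Ctrl A × Ctrl A' → Pred (Sto A × Sto A')) →
               Pred (Sto A × Sto A') → Pred (Sto A × Sto A') → Set
IsAnnotation A A' an Q S = (an (init A , init A') ≐ Q) × (an (fin A , fin A') ≐ S)

Valid : (A A' : Automaton) (L R J K : Pred (PState A A')) →
        (Ctrl A × Ctrl A' → Pred (Sto A × Sto A')) → Set
Valid A A' L R J K an =
  ∀ {c ss d tt} → an c ss → Filtered A A' L R J K (c , ss) (d , tt) → an d tt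

{-# OPTIONS --safe #-}
module Submission where

-- Let each side step whenever it can, and keep exactly the states satisfying the annotation
-- that is Q at (init, init), S at (fin, fin) and trivial elsewhere; validity is then immediate.
-- For adequacy, a left run and the right run provided by ⟨Q ⇝ S⟩ are scheduled as one joint
-- step (both sides leave their initial point), then the rest of the left run, then the rest of
-- the right run.  The product never revisits (init, init), and it reaches (fin, fin) only at the
-- very end because final control points have no successors.

open import Defs
open import Data.Product using (_×_; Σ; ∃-syntax; _,_; proj₁; proj₂)
open import Data.Sum using (_⊎_; inj₁; inj₂)
open import Data.Empty using (⊥-elim)
open import Relation.Binary.PropositionalEquality using (_≡_; _≢_; refl; sym)
open import Relation.Binary.Construct.Closure.ReflexiveTransitive using (Star; ε; _◅_)

Enabled : (B : Automaton) → Pred (Ctrl B × Sto B)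
Enabled B (n , s) = ∃[ m ] ∃[ t ] (_⟶_ B) (n , s) (m , t)

run-from-fin : (B : Automaton) {n : Ctrl B} {s : Sto B} {y : Ctrl B × Sto B} →
               n ≡ fin B → B ⊢ (n , s) ⟶* y → (n , s) ≡ y
run-from-fin B _ ε = refl
run-from-fin B n≡fin (step ◅ _) = ⊥-elim (noFromFin B step n≡fin)

module _ (A A' : Automaton) where

  LeftEnabled RightEnabled BothEnabled : Pred (PState A A')
  LeftEnabled ((n , _) , (s , _)) = Enabled A (n , s)
  RightEnabled ((_ , n') , (_ , s')) = Enabled A' (n' , s')
  BothEnabled X = LeftEnabled X × RightEnabled X

  enabled-live : Live A A' LeftEnabled RightEnabled BothEnabled
  enabled-live = (λ _ _ _ _ en → en) , (λ _ _ _ _ en → en) , (λ _ _ _ _ en → en)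

module _ (A A' : Automaton) (Q S : Pred (Sto A × Sto A')) where

  endpointAnnotation : Ctrl A × Ctrl A' → Pred (Sto A × Sto A')
  endpointAnnotation (n , n') ss =
    (n ≡ init A → n' ≡ init A' → Q ss) × (n ≡ fin A → n' ≡ fin A' → S ss)

  Keep : Pred (PState A A')
  Keep (c , ss) = endpointAnnotation c ss

  endpointAnnotation-isAnnotation : IsAnnotation A A' endpointAnnotation Q S
  endpointAnnotation-isAnnotation =
    (λ _ → (λ an → proj₁ an refl refl) ,
           (λ q → (λ _ _ → q) , (λ init≡fin _ → ⊥-elim (init≢fin A init≡fin)))) ,
    (λ _ → (λ an → proj₂ an refl refl) ,
           (λ s → (λ fin≡init _ → ⊥-elim (init≢fin A (sym fin≡init))) , (λ _ _ → s)))

  keep-valid : Valid A A' (LeftEnabled A A') (RightEnabled A A') (BothEnabled A A') Keep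
                 endpointAnnotation
  keep-valid _ (_ , kept) = kept

  _⇒_ : PState A A' → PState A A' → Set
  _⇒_ = Filtered A A' (LeftEnabled A A') (RightEnabled A A') (BothEnabled A A') Keep

  keep-off-init : ∀ {m m' u u' t t'} → m ≢ init A ⊎ m' ≢ init A' →
                  A ⊢ (m , u) ⟶* (fin A , t) → A' ⊢ (m' , u') ⟶* (fin A' , t') → S (t , t') →
                  Keep ((m , m') , (u , u'))
  keep-off-init {m} {m'} {u} {u'} off p p' st = at-init off , at-fin
    where
    at-init : m ≢ init A ⊎ m' ≢ init A' → m ≡ init A → m' ≡ init A' → Q (u , u')
    at-init (inj₁ m≢init) m≡init _ = ⊥-elim (m≢init m≡init)
    at-init (inj₂ m'≢init) _ m'≡init = ⊥-elim (m'≢init m'≡init)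

    at-fin : m ≡ fin A → m' ≡ fin A' → S (u , u')
    at-fin m≡fin m'≡fin with run-from-fin A m≡fin p | run-from-fin A' m'≡fin p'
    ... | refl | refl = st

  right-run : ∀ {m' u' t t'} → A' ⊢ (m' , u') ⟶* (fin A' , t') → S (t , t') →
              Star _⇒_ ((fin A , m') , (t , u')) ((fin A , fin A') , (t , t'))
  right-run ε st = ε
  right-run (_◅_ {j = _ , _} step rest) st =
    (RO (_ , _ , step) step , keep-off-init (inj₁ fin≢init) ε rest st) ◅ right-run rest st
    where
    fin≢init : fin A ≢ init A
    fin≢init fin≡init = init≢fin A (sym fin≡init)

  left-run : ∀ {n m' u u' t t'} → m' ≢ init A' →
             A ⊢ (n , u) ⟶* (fin A , t) → A' ⊢ (m' , u') ⟶* (fin A' , t') → S (t , t') →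
             Star _⇒_ ((n , m') , (u , u')) ((fin A , fin A') , (t , t'))
  left-run _ ε p' st = right-run p' st
  left-run m'≢init (_◅_ {j = _ , _} step rest) p' st =
    (LO (_ , _ , step) step , keep-off-init (inj₂ m'≢init) rest p' st) ◅ left-run m'≢init rest p' st

  aligned-run : ∀ {n n' s s' t t'} → n ≡ init A → n' ≡ init A' →
                A ⊢ (n , s) ⟶* (fin A , t) → A' ⊢ (n' , s') ⟶* (fin A' , t') → S (t , t') →
                Star _⇒_ ((n , n') , (s , s')) ((fin A , fin A') , (t , t'))
  aligned-run fin≡init _ ε _ _ = ⊥-elim (init≢fin A (sym fin≡init))
  aligned-run _ fin≡init (_ ◅ _) ε _ = ⊥-elim (init≢fin A' (sym fin≡init))
  aligned-run refl refl (_◅_ {j = _ , _} step rest) (_◅_ {j = _ , _} step' rest') st =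
    (JO ((_ , _ , step) , (_ , _ , step')) step step' ,
     keep-off-init (inj₁ (λ m≡init → noSelf A step (sym m≡init))) rest rest' st)
    ◅ left-run (λ m'≡init → noSelf A' step' (sym m'≡init)) rest rest' st

  sat⇒adequate : Sat A A' Q S →
                 Adequate A A' (LeftEnabled A A') (RightEnabled A A') (BothEnabled A A') Keep Q
  sat⇒adequate sat s s' t q p =
    let t' , p' , st = sat s s' t q p in t' , aligned-run refl refl p p' st

lemma7p6 : (A A' : Automaton) (Q S : Pred (Sto A × Sto A')) →
    Sat A A' Q S →
    Σ (Pred (PState A A')) λ L → Σ (Pred (PState A A')) λ R →
    Σ (Pred (PState A A')) λ J → Σ (Pred (PState A A')) λ K →
    Σ (Ctrl A × Ctrl A' → Pred (Sto A × Sto A')) λ an →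
      Live A A' L R J × IsAnnotation A A' an Q S ×
      Adequate A A' L R J K Q × Valid A A' L R J K an
lemma7p6 A A' Q S sat =
  LeftEnabled A A' , RightEnabled A A' , BothEnabled A A' , Keep A A' Q S ,
  endpointAnnotation A A' Q S ,
  enabled-live A A' , endpointAnnotation-isAnnotation A A' Q S ,
  sat⇒adequate A A' Q S sat , keep-valid A A' Q S
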